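{- Let $n\ge 1$ and let $\mathcal{N}$ be an $n$-normalized family, and let $M$ be any minimal (with respect to inclusion) non-empty member of $\mathcal{N}$. Then the family $$\mathcal{N}'=(\mathcal{N}\setminus\{M\})\ominus\{a_{\mathcal{N}}\}=\{N\setminus\{a_{\mathcal{N}}\}: N\in\mathcal{N},\ N\neq M\}$$ is $(n-1)$-normalized.
   Context: All families are finite sets of finite sets. The universe $U(\mathcal{F})$ of a family $\mathcal{F}$ is the union of its members. A family $\mathcal{F}$ is union-closed if $F\cup G\in\mathcal{F}$ for all $F,G\in\mathcal{F}$. It is separating if for any two distinct $a,b\in U(\mathcal{F})$ there is $O\in\mathcal{F}$ with $|O\cap\{a,b\}|=1$. A family $\mathcal{N}$ is normalized if it is separating, union-closed, $\emptyset\in\mathcal{N}$, and $|\mathcal{N}|=|U(\mathcal{N})|+1$; it is $n$-normalized if moreover $|U(\mathcal{N})|=n$. For a normalized family $\mathcal{N}$ with non-empty universe there is exactly one element of $U(\mathcal{N})$ that belongs to every non-empty member of $\mathcal{N}$; this element is denoted $a_{\mathcal{N}}$. For a family $\mathcal{F}$ and a set $S$, $\mathcal{F}\ominus S=\{F\setminus S: F\in\mathcal{F}\}$. -}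

module Defs where

open import Data.Nat using (ℕ; suc)
open import Data.Bool using (Bool)
import Data.Bool.Properties as BoolP
open import Data.Fin using (Fin)
open import Data.Fin.Subset using (Subset; ⊥; _∪_; _∈_; _∉_; _⊆_; _─_; ⁅_⁆; ∣_∣; Nonempty)
open import Data.Vec.Properties using (≡-dec)
open import Data.List using (List; foldr; map; filter; length; deduplicate)
import Data.List.Membership.Propositional as LMem
open import Data.Product using (Σ; ∃; _×_; _,_)
open import Data.Sum using (_⊎_)
open import Relation.Nullary using (¬_; ¬?)
open import Relation.Binary.Definitions using (DecidableEquality)
open import Relation.Binary.PropositionalEquality using (_≡_; _≢_)

-- Sets are subsets of a finite ground set Fin m (any finite universe embeds).
-- A family is a list of subsets, read as the finite SET of its entries
-- (duplicates in the list are irrelevant).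

_≟ₛ_ : ∀ {m} → DecidableEquality (Subset m)
_≟ₛ_ = ≡-dec BoolP._≟_

Family : ℕ → Set
Family m = List (Subset m)

_∈F_ : ∀ {m} → Subset m → Family m → Set
A ∈F 𝓕 = LMem._∈_ A 𝓕

card : ∀ {m} → Family m → ℕ
card 𝓕 = length (deduplicate _≟ₛ_ 𝓕)

U : ∀ {m} → Family m → Subset m
U 𝓕 = foldr _∪_ ⊥ 𝓕

UnionClosed : ∀ {m} → Family m → Set
UnionClosed 𝓕 = ∀ {A B} → A ∈F 𝓕 → B ∈F 𝓕 → (A ∪ B) ∈F 𝓕

Separating : ∀ {m} → Family m → Set
Separating {m} 𝓕 =
  ∀ (a b : Fin m) → a ∈ U 𝓕 → b ∈ U 𝓕 → a ≢ b →
  Σ (Subset m) λ O → O ∈F 𝓕 × ((a ∈ O × b ∉ O) ⊎ (b ∈ O × a ∉ O))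

Normalized : ∀ {m} → Family m → Set
Normalized 𝓕 = Separating 𝓕 × UnionClosed 𝓕 × ⊥ ∈F 𝓕 × card 𝓕 ≡ suc ∣ U 𝓕 ∣

NNormalized : ∀ {m} → ℕ → Family m → Set
NNormalized n 𝓕 = Normalized 𝓕 × ∣ U 𝓕 ∣ ≡ n

-- a is the element of U(𝓝) lying in every non-empty member (a_𝓝)
IsApex : ∀ {m} → Family m → Fin m → Set
IsApex 𝓝 a = a ∈ U 𝓝 × (∀ {N} → N ∈F 𝓝 → Nonempty N → a ∈ N)

MinimalNonempty : ∀ {m} → Family m → Subset m → Set
MinimalNonempty 𝓝 M =
  M ∈F 𝓝 × Nonempty M × (∀ {N} → N ∈F 𝓝 → Nonempty N → N ⊆ M → N ≡ M)

_⊖_ : ∀ {m} → Family m → Subset m → Family m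
𝓕 ⊖ S = map (λ F → F ─ S) 𝓕

removeMember : ∀ {m} → Family m → Subset m → Family m
removeMember 𝓝 M = filter (λ N → ¬? (N ≟ₛ M)) 𝓝

-- Every non-empty member contains a, so deleting a from the members other than M
-- loses no information: S ↦ S ∖ {a} is injective on them, and union-closedness
-- survives because two members different from M cannot have M as their union
-- (by minimality of M). The only delicate point is separation: if x ∈ M and y ∉ M
-- are separated only by M, take a member O with a ∈ O and x ∉ O (it exists since
-- a is the apex); then O itself or M ∪ O separates x and y, and neither equals M.
-- Finally a ∈ U 𝓝, so universe and number of members both drop by one.
module Submission where

open import Data.Empty using (⊥-elim)
open import Data.Fin using (Fin)
import Data.Fin.Properties as Fin
open import Data.Fin.Subset
  using (Subset; inside; outside; ⊥; _∪_; _∈_; _∉_; _⊆_; _─_; _-_; ⁅_⁆; ∣_∣; Nonempty)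
open import Data.Fin.Subset.Properties
open import Data.List using (List; []; _∷_; map; length; deduplicate)
open import Data.Vec using ([]; _∷_; here; there)
open import Data.List.Properties using (length-map)
open import Data.List.Membership.Propositional.Properties
  using (∈-map⁺; ∈-map⁻; ∈-filter⁺; ∈-filter⁻; ∈-deduplicate⁺; ∈-deduplicate⁻; deduplicate-∈⇔)
open import Data.List.Membership.Propositional.Properties.WithK using (unique∧set⇒bag)
import Data.List.Membership.Propositional as List
open import Data.List.Relation.Unary.Any using (here; there)
import Data.List.Relation.Unary.All as All
import Data.List.Relation.Unary.All.Properties as All
open import Data.List.Relation.Unary.AllPairs using ([]; _∷_)
open import Data.List.Relation.Unary.Unique.Propositional using (Unique)
import Data.List.Relation.Unary.Unique.Propositional.Properties as Unique
open import Data.List.Relation.Unary.Unique.DecPropositional.Properties using (deduplicate-!)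
open import Data.List.Relation.Binary.BagAndSetEquality using (_∼[_]_; set; map-cong; ∼bag⇒↭)
open import Data.List.Relation.Binary.Permutation.Propositional.Properties using (↭-length)
open import Data.Nat using (ℕ; suc; _≤_; _∸_)
open import Data.Nat.Properties using (suc-injective)
open import Data.Product using (∃; _×_; _,_; proj₁; proj₂)
open import Data.Sum using (_⊎_; inj₁; inj₂)
open import Function using (_∘_)
open import Function.Bundles using (_⇔_; mk⇔; Equivalence)
import Function.Properties.Equivalence as ⇔
open import Relation.Binary.PropositionalEquality
open import Relation.Nullary using (¬?; yes; no)

open import Defs

x∈p─q⇒x∉q : ∀ {n} {x : Fin n} (p q : Subset n) → x ∈ p ─ q → x ∉ q
x∈p─q⇒x∉q (_ ∷ p) (inside  ∷ q) (there x∈p─q) (there x∈q) = x∈p─q⇒x∉q p q x∈p─q x∈q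
x∈p─q⇒x∉q (_ ∷ p) (outside ∷ q) (there x∈p─q) (there x∈q) = x∈p─q⇒x∉q p q x∈p─q x∈q

x∈p-y⇒x≢y : ∀ {n} {x y : Fin n} (p : Subset n) → x ∈ p - y → x ≢ y
x∈p-y⇒x≢y {y = y} p = x∉⁅y⁆⇒x≢y ∘ x∈p─q⇒x∉q p ⁅ y ⁆

⊥─p≡⊥ : ∀ {n} (p : Subset n) → ⊥ ─ p ≡ ⊥
⊥─p≡⊥ p = ⊆-antisym (p─q⊆p ⊥ p) ⊥⊆

p∪q─r≡p─r∪q─r : ∀ {n} (p q r : Subset n) → (p ∪ q) ─ r ≡ (p ─ r) ∪ (q ─ r)
p∪q─r≡p─r∪q─r []      []      []            = refl
p∪q─r≡p─r∪q─r (_ ∷ p) (_ ∷ q) (inside  ∷ r) = cong (outside ∷_) (p∪q─r≡p─r∪q─r p q r)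
p∪q─r≡p─r∪q─r (_ ∷ p) (_ ∷ q) (outside ∷ r) = cong (_ ∷_) (p∪q─r≡p─r∪q─r p q r)

x∈p⇒suc∣p-x∣≡∣p∣ : ∀ {n} {x : Fin n} (p : Subset n) → x ∈ p → suc ∣ p - x ∣ ≡ ∣ p ∣
x∈p⇒suc∣p-x∣≡∣p∣ (inside  ∷ p) here          = cong (suc ∘ ∣_∣) (p─⊥≡p p)
x∈p⇒suc∣p-x∣≡∣p∣ (inside  ∷ p) (there x∈p)   = cong suc (x∈p⇒suc∣p-x∣≡∣p∣ p x∈p)
x∈p⇒suc∣p-x∣≡∣p∣ (outside ∷ p) (there x∈p)   = x∈p⇒suc∣p-x∣≡∣p∣ p x∈p

Separates : ∀ {n} → Fin n → Fin n → Subset n → Set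
Separates x y O = (x ∈ O × y ∉ O) ⊎ (y ∈ O × x ∉ O)

Separates-sym : ∀ {n} {x y : Fin n} {O} → Separates x y O → Separates y x O
Separates-sym (inj₁ s) = inj₂ s
Separates-sym (inj₂ s) = inj₁ s

Separates-─ : ∀ {n} {x y : Fin n} {O} q → x ∉ q → y ∉ q → Separates x y O → Separates x y (O ─ q)
Separates-─ q x∉q y∉q (inj₁ (x∈O , y∉O)) = inj₁ (x∈p∧x∉q⇒x∈p─q x∈O x∉q , y∉O ∘ p─q⊆p _ q)
Separates-─ q x∉q y∉q (inj₂ (y∈O , x∉O)) = inj₂ (x∈p∧x∉q⇒x∈p─q y∈O y∉q , x∉O ∘ p─q⊆p _ q)

Unique-map⁺ : ∀ {A B : Set} {f : A → B} {xs : List A} →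
  (∀ {u v} → u List.∈ xs → v List.∈ xs → f u ≡ f v → u ≡ v) →
  Unique xs → Unique (map f xs)
Unique-map⁺ f-inj [] = []
Unique-map⁺ f-inj (x∉xs ∷ xs!) =
  All.map⁺ (All.tabulate λ v∈ fx≡fv → All.lookup x∉xs v∈ (f-inj (here refl) (there v∈) fx≡fv))
  ∷ Unique-map⁺ (λ u∈ v∈ → f-inj (there u∈) (there v∈)) xs!

module _ {m : ℕ} where

  ∈U⁺ : ∀ {𝓕 : Family m} {S x} → S ∈F 𝓕 → x ∈ S → x ∈ U 𝓕
  ∈U⁺ (here refl) x∈S = x∈p∪q⁺ (inj₁ x∈S)
  ∈U⁺ (there S∈)  x∈S = x∈p∪q⁺ (inj₂ (∈U⁺ S∈ x∈S))

  ∈U⁻ : ∀ (𝓕 : Family m) {x} → x ∈ U 𝓕 → ∃ λ S → S ∈F 𝓕 × x ∈ S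
  ∈U⁻ []      x∈⊥ = ⊥-elim (∉⊥ x∈⊥)
  ∈U⁻ (T ∷ 𝓕) x∈U with x∈p∪q⁻ T (U 𝓕) x∈U
  ... | inj₁ x∈T = T , here refl , x∈T
  ... | inj₂ x∈U𝓕 with ∈U⁻ 𝓕 x∈U𝓕
  ...   | S , S∈ , x∈S = S , there S∈ , x∈S

  U∈ : ∀ {𝓕 : Family m} → UnionClosed 𝓕 → ⊥ ∈F 𝓕 → U 𝓕 ∈F 𝓕
  U∈ {𝓕} ∪-closed ⊥∈ = U-sub∈ 𝓕 (λ S∈ → S∈)
    where
    U-sub∈ : ∀ 𝓖 → (∀ {S} → S ∈F 𝓖 → S ∈F 𝓕) → U 𝓖 ∈F 𝓕
    U-sub∈ []      _   = ⊥∈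
    U-sub∈ (T ∷ 𝓖) 𝓖⊆𝓕 = ∪-closed (𝓖⊆𝓕 (here refl)) (U-sub∈ 𝓖 (𝓖⊆𝓕 ∘ there))

  ∈-removeMember⇔ : ∀ (𝓕 : Family m) M {S} → S ∈F removeMember 𝓕 M ⇔ (S ∈F 𝓕 × S ≢ M)
  ∈-removeMember⇔ 𝓕 M =
    mk⇔ (∈-filter⁻ (λ N → ¬? (N ≟ₛ M))) (λ (S∈ , S≢M) → ∈-filter⁺ (λ N → ¬? (N ≟ₛ M)) S∈ S≢M)

  ∈-deduplicate⇔ : ∀ (𝓕 : Family m) → 𝓕 ∼[ set ] deduplicate _≟ₛ_ 𝓕
  ∈-deduplicate⇔ _ = deduplicate-∈⇔ _≟ₛ_

  card≡length : ∀ (𝓕 : Family m) {𝓖} → Unique 𝓖 → 𝓕 ∼[ set ] 𝓖 → card 𝓕 ≡ length 𝓖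
  card≡length 𝓕 𝓖! 𝓕∼𝓖 = ↭-length (∼bag⇒↭
    (unique∧set⇒bag (deduplicate-! _≟ₛ_ 𝓕) 𝓖! (⇔.trans (⇔.sym (∈-deduplicate⇔ 𝓕)) 𝓕∼𝓖)))

  removeMember-cong : ∀ {𝓕 𝓖 : Family m} M →
                      𝓕 ∼[ set ] 𝓖 → removeMember 𝓕 M ∼[ set ] removeMember 𝓖 M
  removeMember-cong {𝓕} {𝓖} M 𝓕∼𝓖 =
    mk⇔ (transport 𝓕 𝓖 (Equivalence.to 𝓕∼𝓖)) (transport 𝓖 𝓕 (Equivalence.from 𝓕∼𝓖))
    where
    transport : ∀ 𝓕 𝓖 {S} → (S ∈F 𝓕 → S ∈F 𝓖) → S ∈F removeMember 𝓕 M → S ∈F removeMember 𝓖 M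
    transport 𝓕 𝓖 𝓕⊆𝓖 S∈ with S∈𝓕 , S≢M ← Equivalence.to (∈-removeMember⇔ 𝓕 M) S∈ =
      Equivalence.from (∈-removeMember⇔ 𝓖 M) (𝓕⊆𝓖 S∈𝓕 , S≢M)

  card-removeMember : ∀ {𝓕 : Family m} {M} → M ∈F 𝓕 → suc (card (removeMember 𝓕 M)) ≡ card 𝓕
  card-removeMember {𝓕} {M} M∈𝓕 = begin
    suc (card (removeMember 𝓕 M))
      ≡⟨ cong suc (card≡length (removeMember 𝓕 M) 𝓓∖M! (removeMember-cong M (∈-deduplicate⇔ 𝓕))) ⟩
    length (M ∷ removeMember 𝓓 M)  ≡⟨ card≡length 𝓕 (M∉𝓓∖M ∷ 𝓓∖M!) (mk⇔ to from) ⟨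
    card 𝓕                         ∎
    where
    open ≡-Reasoning
    𝓓 = deduplicate _≟ₛ_ 𝓕

    𝓓∖M! : Unique (removeMember 𝓓 M)
    𝓓∖M! = Unique.filter⁺ (λ N → ¬? (N ≟ₛ M)) (deduplicate-! _≟ₛ_ 𝓕)

    M∉𝓓∖M : All.All (M ≢_) (removeMember 𝓓 M)
    M∉𝓓∖M = All.tabulate λ S∈ M≡S → proj₂ (Equivalence.to (∈-removeMember⇔ 𝓓 M) S∈) (sym M≡S)

    to : ∀ {S} → S ∈F 𝓕 → S ∈F (M ∷ removeMember 𝓓 M)
    to {S} S∈𝓕 with S ≟ₛ M
    ... | yes refl = here refl
    ... | no S≢M   = there (Equivalence.from (∈-removeMember⇔ 𝓓 M) (∈-deduplicate⁺ _≟ₛ_ S∈𝓕 , S≢M))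
    from : ∀ {S} → S ∈F (M ∷ removeMember 𝓓 M) → S ∈F 𝓕
    from (here refl) = M∈𝓕
    from (there S∈)  = ∈-deduplicate⁻ _≟ₛ_ 𝓕 (proj₁ (Equivalence.to (∈-removeMember⇔ 𝓓 M) S∈))

  card-map : ∀ {𝓕 : Family m} (f : Subset m → Subset m) →
    (∀ {S T} → S ∈F 𝓕 → T ∈F 𝓕 → f S ≡ f T → S ≡ T) → card (map f 𝓕) ≡ card 𝓕
  card-map {𝓕} f f-inj = begin
    card (map f 𝓕)  ≡⟨ card≡length (map f 𝓕) f𝓓! (map-cong (λ _ → refl) (∈-deduplicate⇔ 𝓕)) ⟩
    length (map f 𝓓) ≡⟨ length-map f 𝓓 ⟩
    card 𝓕          ∎
    where
    open ≡-Reasoning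
    𝓓 = deduplicate _≟ₛ_ 𝓕

    f𝓓! : Unique (map f 𝓓)
    f𝓓! = Unique-map⁺ (λ S∈ T∈ → f-inj (∈-deduplicate⁻ _≟ₛ_ 𝓕 S∈) (∈-deduplicate⁻ _≟ₛ_ 𝓕 T∈))
                      (deduplicate-! _≟ₛ_ 𝓕)

module RemoveMinimal {m} {𝓝 : Family m} {M : Subset m} {a : Fin m}
  (separating : Separating 𝓝) (∪-closed : UnionClosed 𝓝) (⊥∈𝓝 : ⊥ ∈F 𝓝)
  (a∈U : a ∈ U 𝓝) (a∈nonempty : ∀ {N} → N ∈F 𝓝 → Nonempty N → a ∈ N)
  (M∈𝓝 : M ∈F 𝓝) (M-nonempty : Nonempty M)
  (M-minimal : ∀ {N} → N ∈F 𝓝 → Nonempty N → N ⊆ M → N ≡ M)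
  where

  𝓝′ : Family m
  𝓝′ = removeMember 𝓝 M ⊖ ⁅ a ⁆

  ∈𝓝′⁺ : ∀ {S} → S ∈F 𝓝 → S ≢ M → (S - a) ∈F 𝓝′
  ∈𝓝′⁺ S∈ S≢M = ∈-map⁺ (_- a) (Equivalence.from (∈-removeMember⇔ 𝓝 M) (S∈ , S≢M))

  ∈𝓝′⁻ : ∀ {T} → T ∈F 𝓝′ → ∃ λ S → S ∈F 𝓝 × S ≢ M × T ≡ S - a
  ∈𝓝′⁻ T∈ with S , S∈ , refl ← ∈-map⁻ (_- a) T∈
              with S∈𝓝 , S≢M ← Equivalence.to (∈-removeMember⇔ 𝓝 M) S∈ = S , S∈𝓝 , S≢M , refl

  a∈M : a ∈ M
  a∈M = a∈nonempty M∈𝓝 M-nonempty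

  ⊥≢M : ⊥ ≢ M
  ⊥≢M ⊥≡M = ∉⊥ (subst (_ ∈_) (sym ⊥≡M) a∈M)

  ∪≢M : ∀ {S T} → S ∈F 𝓝 → T ∈F 𝓝 → S ≢ M → T ≢ M → S ∪ T ≢ M
  ∪≢M {S} {T} S∈ T∈ S≢M T≢M S∪T≡M with x∈p∪q⁻ S T (subst (a ∈_) (sym S∪T≡M) a∈M)
  ... | inj₁ a∈S = S≢M (M-minimal S∈ (a , a∈S) (subst (_ ∈_) S∪T≡M ∘ p⊆p∪q T))
  ... | inj₂ a∈T = T≢M (M-minimal T∈ (a , a∈T) (subst (_ ∈_) S∪T≡M ∘ q⊆p∪q S T))

  apex-separator : ∀ {x} → x ∈ U 𝓝 → x ≢ a → ∃ λ O → O ∈F 𝓝 × a ∈ O × x ∉ O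
  apex-separator x∈U x≢a with separating _ a x∈U a∈U x≢a
  ... | O , O∈ , inj₁ (x∈O , a∉O) = ⊥-elim (a∉O (a∈nonempty O∈ (_ , x∈O)))
  ... | O , O∈ , inj₂ (a∈O , x∉O) = O , O∈ , a∈O , x∉O

  separator-≢M : ∀ {x y} → x ∈ M → y ∉ M → x ≢ a → ∃ λ O → O ∈F 𝓝 × O ≢ M × Separates x y O
  separator-≢M {x} {y} x∈M y∉M x≢a with O , O∈ , a∈O , x∉O ← apex-separator (∈U⁺ M∈𝓝 x∈M) x≢a
      with y ∈? O
  ... | yes y∈O = O , O∈ , O≢M , inj₂ (y∈O , x∉O)
    where
    O≢M : O ≢ M
    O≢M refl = x∉O x∈M
  ... | no y∉O = M ∪ O , ∪-closed M∈𝓝 O∈ , M∪O≢M , inj₁ (p⊆p∪q O x∈M , y∉M∪O)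
    where
    M∪O≢M : M ∪ O ≢ M
    M∪O≢M M∪O≡M with refl ← M-minimal O∈ (a , a∈O) (subst (_ ∈_) M∪O≡M ∘ q⊆p∪q M O) = x∉O x∈M
    y∉M∪O : y ∉ M ∪ O
    y∉M∪O y∈M∪O with x∈p∪q⁻ M O y∈M∪O
    ... | inj₁ y∈M = y∉M y∈M
    ... | inj₂ y∈O = y∉O y∈O

  member-≢M : ∀ {x} → x ∈ U 𝓝 → x ≢ a → ∃ λ S → S ∈F 𝓝 × S ≢ M × x ∈ S
  member-≢M {x} x∈U x≢a with U 𝓝 ≟ₛ M
  ... | no U≢M = U 𝓝 , U∈ ∪-closed ⊥∈𝓝 , U≢M , x∈U
  ... | yes U≡M with O , O∈ , a∈O , x∉O ← apex-separator x∈U x≢a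
      with refl ← M-minimal O∈ (a , a∈O) (subst (_ ∈_) U≡M ∘ ∈U⁺ O∈) =
    ⊥-elim (x∉O (subst (x ∈_) U≡M x∈U))

  U𝓝′≡U𝓝-a : U 𝓝′ ≡ U 𝓝 - a
  U𝓝′≡U𝓝-a = ⊆-antisym ⊆U𝓝-a U𝓝-a⊆
    where
    ⊆U𝓝-a : U 𝓝′ ⊆ U 𝓝 - a
    ⊆U𝓝-a x∈U𝓝′ with T , T∈ , x∈T ← ∈U⁻ 𝓝′ x∈U𝓝′ with S , S∈ , _ , refl ← ∈𝓝′⁻ T∈ =
      x∈p∧x≢y⇒x∈p-y (∈U⁺ S∈ (p─q⊆p S ⁅ a ⁆ x∈T)) (x∈p-y⇒x≢y S x∈T)
    U𝓝-a⊆ : U 𝓝 - a ⊆ U 𝓝′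
    U𝓝-a⊆ x∈U-a with x≢a ← x∈p-y⇒x≢y (U 𝓝) x∈U-a
      with S , S∈ , S≢M , x∈S ← member-≢M (p─q⊆p (U 𝓝) ⁅ a ⁆ x∈U-a) x≢a =
      ∈U⁺ (∈𝓝′⁺ S∈ S≢M) (x∈p∧x≢y⇒x∈p-y x∈S x≢a)

  suc∣U𝓝′∣≡∣U𝓝∣ : suc ∣ U 𝓝′ ∣ ≡ ∣ U 𝓝 ∣
  suc∣U𝓝′∣≡∣U𝓝∣ = trans (cong (suc ∘ ∣_∣) U𝓝′≡U𝓝-a) (x∈p⇒suc∣p-x∣≡∣p∣ (U 𝓝) a∈U)

  ∈U𝓝′⁻ : ∀ {x} → x ∈ U 𝓝′ → x ∈ U 𝓝 × x ≢ a
  ∈U𝓝′⁻ x∈U𝓝′ with x∈U-a ← subst (_ ∈_) U𝓝′≡U𝓝-a x∈U𝓝′ =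
    p─q⊆p (U 𝓝) ⁅ a ⁆ x∈U-a , x∈p-y⇒x≢y (U 𝓝) x∈U-a

  separator-avoiding-M : ∀ {x y} → x ≢ a → y ≢ a → (∃ λ O → O ∈F 𝓝 × Separates x y O) →
                         ∃ λ O → O ∈F 𝓝 × O ≢ M × Separates x y O
  separator-avoiding-M x≢a y≢a (O , O∈ , O-sep) with O ≟ₛ M
  ... | no O≢M = O , O∈ , O≢M , O-sep
  separator-avoiding-M x≢a y≢a (O , O∈ , inj₁ (x∈M , y∉M)) | yes refl = separator-≢M x∈M y∉M x≢a
  separator-avoiding-M x≢a y≢a (O , O∈ , inj₂ (y∈M , x∉M)) | yes refl
    with O′ , O′∈ , O′≢M , O′-sep ← separator-≢M y∈M x∉M y≢a =
    O′ , O′∈ , O′≢M , Separates-sym O′-sep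

  separating′ : Separating 𝓝′
  separating′ x y x∈U𝓝′ y∈U𝓝′ x≢y =
    let x∈U , x≢a = ∈U𝓝′⁻ x∈U𝓝′
        y∈U , y≢a = ∈U𝓝′⁻ y∈U𝓝′
        O , O∈ , O≢M , O-sep = separator-avoiding-M x≢a y≢a (separating x y x∈U y∈U x≢y)
    in O - a , ∈𝓝′⁺ O∈ O≢M , Separates-─ ⁅ a ⁆ (x≢y⇒x∉⁅y⁆ x≢a) (x≢y⇒x∉⁅y⁆ y≢a) O-sep

  ∪-closed′ : UnionClosed 𝓝′
  ∪-closed′ S-a∈ T-a∈ with S , S∈ , S≢M , refl ← ∈𝓝′⁻ S-a∈ | T , T∈ , T≢M , refl ← ∈𝓝′⁻ T-a∈ =
    subst (_∈F 𝓝′) (p∪q─r≡p─r∪q─r S T ⁅ a ⁆) (∈𝓝′⁺ (∪-closed S∈ T∈) (∪≢M S∈ T∈ S≢M T≢M))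

  ⊥∈𝓝′ : ⊥ ∈F 𝓝′
  ⊥∈𝓝′ = subst (_∈F 𝓝′) (⊥─p≡⊥ ⁅ a ⁆) (∈𝓝′⁺ ⊥∈𝓝 ⊥≢M)

  nonempty⇒nonempty-a : ∀ {S} → S ∈F 𝓝 → S ≢ M → Nonempty S → Nonempty (S - a)
  nonempty⇒nonempty-a {S} S∈ S≢M S-nonempty with nonempty? (S - a)
  ... | yes S-a-nonempty = S-a-nonempty
  ... | no S-a-empty = ⊥-elim (S≢M (M-minimal S∈ S-nonempty S⊆M))
    where
    S⊆M : S ⊆ M
    S⊆M {z} z∈S with z Fin.≟ a
    ... | yes refl = a∈M
    ... | no z≢a = ⊥-elim (S-a-empty (z , x∈p∧x≢y⇒x∈p-y z∈S z≢a))

  -a-injective : ∀ {S T} → S ∈F 𝓝 → S ≢ M → T ∈F 𝓝 → T ≢ M → S - a ≡ T - a → S ≡ T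
  -a-injective S∈ S≢M T∈ T≢M S-a≡T-a =
    ⊆-antisym (⊆-from-a S∈ S≢M T∈ S-a≡T-a) (⊆-from-a T∈ T≢M S∈ (sym S-a≡T-a))
    where
    ⊆-from-a : ∀ {S T} → S ∈F 𝓝 → S ≢ M → T ∈F 𝓝 → S - a ≡ T - a → S ⊆ T
    ⊆-from-a {S} {T} S∈ S≢M T∈ S-a≡T-a {x} x∈S with x Fin.≟ a
    ... | no x≢a = p─q⊆p T ⁅ a ⁆ (subst (x ∈_) S-a≡T-a (x∈p∧x≢y⇒x∈p-y x∈S x≢a))
    ... | yes refl with z , z∈S-a ← nonempty⇒nonempty-a S∈ S≢M (x , x∈S) =
      a∈nonempty T∈ (z , p─q⊆p T ⁅ a ⁆ (subst (z ∈_) S-a≡T-a z∈S-a))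

  suc-card𝓝′≡card𝓝 : suc (card 𝓝′) ≡ card 𝓝
  suc-card𝓝′≡card𝓝 = trans (cong suc (card-map (_- a) -a-injective′)) (card-removeMember M∈𝓝)
    where
    -a-injective′ : ∀ {S T} → S ∈F removeMember 𝓝 M → T ∈F removeMember 𝓝 M →
                    S - a ≡ T - a → S ≡ T
    -a-injective′ S∈ T∈ with S∈𝓝 , S≢M ← Equivalence.to (∈-removeMember⇔ 𝓝 M) S∈
                          | T∈𝓝 , T≢M ← Equivalence.to (∈-removeMember⇔ 𝓝 M) T∈ =
      -a-injective S∈𝓝 S≢M T∈𝓝 T≢M

  normalized′ : card 𝓝 ≡ suc ∣ U 𝓝 ∣ → Normalized 𝓝′
  normalized′ card𝓝≡ = separating′ , ∪-closed′ , ⊥∈𝓝′ , suc-injective (begin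
    suc (card 𝓝′)       ≡⟨ suc-card𝓝′≡card𝓝 ⟩
    card 𝓝              ≡⟨ card𝓝≡ ⟩
    suc ∣ U 𝓝 ∣          ≡⟨ cong suc suc∣U𝓝′∣≡∣U𝓝∣ ⟨
    suc (suc ∣ U 𝓝′ ∣)   ∎)
    where open ≡-Reasoning

theorem4p11 : ∀ {m} (n : ℕ) (𝓝 : Family m) (M : Subset m) (a : Fin m) →
    1 ≤ n → NNormalized n 𝓝 → IsApex 𝓝 a → MinimalNonempty 𝓝 M →
    NNormalized (n ∸ 1) (removeMember 𝓝 M ⊖ ⁅ a ⁆)
theorem4p11 n 𝓝 M a _ ((separating , ∪-closed , ⊥∈𝓝 , card𝓝≡) , ∣U𝓝∣≡n)
                       (a∈U , a∈nonempty) (M∈𝓝 , M-nonempty , M-minimal) =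
  normalized′ card𝓝≡ , cong (_∸ 1) (trans suc∣U𝓝′∣≡∣U𝓝∣ ∣U𝓝∣≡n)
  where
  open RemoveMinimal separating ∪-closed ⊥∈𝓝 a∈U a∈nonempty M∈𝓝 M-nonempty M-minimal
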